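{- Let $\bar z$ be an optimal solution of [GKC] satisfying $1\ge\bar z_{i1}\ge\dots\ge\bar z_{im}\ge0$ for all $i\in N$, and define $\bar a$, $\bar D$, $\bar m_i$ and the linear program [R-GKC] as in the context. Let $z^*$ be an optimal extreme point solution of [R-GKC]. Then there is at most one item $i\in N$ such that $z^*_{ij}\in(0,1)$ for some $j$; every other item $k\in N\setminus\{i\}$ satisfies $z^*_{kj}\in\{0,1\}$ for all $j$.
   Context: Non-Linear Knapsack-Cover setting: a finite set $N$ of items, a demand $D\in\mathbb{N}$, an integer $m\le D$, $M=\{1,\dots,m\}$, and for each $i\in N$ a non-decreasing function $f_i:\{0,\dots,m\}\to\mathbb{Q}_{\ge0}\cup\{\infty\}$; $g_{ij}=f_i(j)-f_i(j-1)$. For $a\in\{0,\dots,m\}^N$ let $D(a)=\max\{D-\sum_i a_i,0\}$ and $m_i(a)=\min\{m,a_i+D(a)\}$. [GKC] is: minimize $\sum_{i,j}g_{ij}z_{ij}$ over $z\in\mathbb{R}^{N\times M}_{\ge0}$ subject to $\sum_{i\in N}\sum_{j=a_i+1}^{m_i(a)}\min\{z_{ij},\dots,z_{i1}\}\ge D(a)$ for all $a\in\{0,\dots,m\}^N$. Given $\bar z$, let $\bar a_i=\max\{j\in M:\bar z_{ij}\ge1/2\}$ (with $\bar a_i=0$ if no such $j$), $\bar D=D(\bar a)$, $\bar m_i=m_i(\bar a)$. [R-GKC] is the LP in variables $z_{ij}$, $i\in N$, $j\in\{\bar a_i+1,\dots,\bar m_i\}$: minimize $\sum_{i\in N}\sum_{j=\bar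 a_i+1}^{\bar m_i}g_{ij}z_{ij}$ subject to $\sum_{i\in N}\sum_{j=\bar a_i+1}^{\bar m_i}z_{ij}\ge2\bar D$ and $1\ge z_{i,\bar a_i+1}\ge z_{i,\bar a_i+2}\ge\dots\ge z_{i,\bar m_i}\ge0$ for all $i\in N$.
   Formalization: The solutions $\bar z$ and $z^*$, and the feasible points against which their optimality and extremality are tested, have rational entries rather than real ones. -}

module Defs where

open import Data.Nat as ℕ using (ℕ; zero; suc; _∸_) renaming (_+_ to _+ℕ_; _*_ to _*ℕ_; _⊓_ to _⊓ℕ_)
import Data.Nat.Properties as ℕP
open import Data.Fin using (Fin; zero; suc; toℕ; fromℕ<)
open import Data.Integer using (+_)
open import Data.Rational using (ℚ; 0ℚ; 1ℚ; ½; _+_; _*_; _-_; _⊓_; _≤_; _<_; _/_)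
open import Data.Rational.Properties using (_≤?_)
open import Data.Product using (Σ; ∃; _×_; _,_)
open import Data.Sum using (_⊎_)
open import Relation.Nullary using (yes; no; ¬_)
open import Relation.Binary.PropositionalEquality using (_≡_)

ℕ→ℚ : ℕ → ℚ
ℕ→ℚ k = + k / 1

Σℚ : {n : ℕ} → (Fin n → ℚ) → ℚ
Σℚ {zero}  h = 0ℚ
Σℚ {suc n} h = h zero + Σℚ (λ i → h (suc i))

Σℕ : {n : ℕ} → (Fin n → ℕ) → ℕ
Σℕ {zero}  h = 0
Σℕ {suc n} h = h zero +ℕ Σℕ (λ i → h (suc i))

sumFrom : (ℕ → ℚ) → ℕ → ℕ → ℚ
sumFrom h lo zero    = 0ℚ
sumFrom h lo (suc c) = h (suc lo) + sumFrom h (suc lo) c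

-- Σ_{j = lo+1}^{hi} h j   (empty when hi ≤ lo)
sumRange : (ℕ → ℚ) → ℕ → ℕ → ℚ
sumRange h lo hi = sumFrom h lo (hi ∸ lo)

data ℚ∞ : Set where
  fin : ℚ → ℚ∞
  ∞   : ℚ∞

data _≤∞_ : ℚ∞ → ℚ∞ → Set where
  fin≤fin : {p q : ℚ} → p ≤ q → fin p ≤∞ fin q
  _≤∞∞    : (x : ℚ∞) → x ≤∞ ∞

_+∞_ : ℚ∞ → ℚ∞ → ℚ∞
fin p +∞ fin q = fin (p + q)
fin p +∞ ∞     = ∞
∞     +∞ y     = ∞

-- cost coefficient times a (non-negative) variable value,
-- with the convention ∞ · 0 = 0
_·∞_ : ℚ∞ → ℚ → ℚ∞
fin c ·∞ z = fin (c * z)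
∞     ·∞ z with z Data.Rational.≟ 0ℚ
... | yes _ = fin 0ℚ
... | no  _ = ∞

Σ∞ : {n : ℕ} → (Fin n → ℚ∞) → ℚ∞
Σ∞ {zero}  h = fin 0ℚ
Σ∞ {suc n} h = h zero +∞ Σ∞ (λ i → h (suc i))

NonNeg∞ : ℚ∞ → Set
NonNeg∞ (fin p) = 0ℚ ≤ p
NonNeg∞ ∞       = Data.Unit.⊤
  where import Data.Unit

-- Problem data.  Items N = Fin n; f i : {0,…,m} → ℚ≥0 ∪ {∞} is given as
-- a function on ℕ of which only the values at 0,…,m are used.

-- g_ij = f_i(j) - f_i(j-1)   (∞ as soon as f_i(j) = ∞; by monotonicity
-- f_i(j-1) = ∞ forces f_i(j) = ∞).  Used only for 1 ≤ j ≤ m.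
gcoef : {n : ℕ} → (Fin n → ℕ → ℚ∞) → Fin n → ℕ → ℚ∞
gcoef f i zero    = fin 0ℚ
gcoef f i (suc j) with f i (suc j) | f i j
... | fin a | fin b = fin (a - b)
... | _     | _     = ∞

-- GKC variables: z i j' with j' : Fin m standing for j = j' + 1 ∈ M.
-- zAt z j = z_j for 1 ≤ j ≤ m (0 elsewhere, never used).
zAt : {m : ℕ} → (Fin m → ℚ) → ℕ → ℚ
zAt {m} z zero = 0ℚ
zAt {m} z (suc j) with j ℕ.<? m
... | yes p = z (fromℕ< p)
... | no  _ = 0ℚ

prefMin : {m : ℕ} → (Fin m → ℚ) → ℕ → ℚ
prefMin z zero          = zAt z zero
prefMin z (suc zero)    = zAt z 1
prefMin z (suc (suc k)) = prefMin z (suc k) ⊓ zAt z (suc (suc k))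

Dof : {n m : ℕ} → ℕ → (Fin n → Fin (suc m)) → ℕ
Dof D a = D ∸ Σℕ (λ i → toℕ (a i))

mOf : {n : ℕ} → (m D : ℕ) → (Fin n → Fin (suc m)) → Fin n → ℕ
mOf m D a i = m ⊓ℕ (toℕ (a i) +ℕ Dof D a)

GKCFeasible : (n m D : ℕ) → (Fin n → Fin m → ℚ) → Set
GKCFeasible n m D z =
  (∀ i j → 0ℚ ≤ z i j) ×
  (∀ (a : Fin n → Fin (suc m)) →
     ℕ→ℚ (Dof D a) ≤
       Σℚ (λ i → sumRange (prefMin (z i)) (toℕ (a i)) (mOf m D a i)))

GKCCost : (n m : ℕ) → (Fin n → ℕ → ℚ∞) → (Fin n → Fin m → ℚ) → ℚ∞
GKCCost n m f z = Σ∞ (λ i → Σ∞ (λ (j : Fin m) → gcoef f i (suc (toℕ j)) ·∞ z i j))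

GKCOptimal : (n m D : ℕ) → (Fin n → ℕ → ℚ∞) → (Fin n → Fin m → ℚ) → Set
GKCOptimal n m D f z =
  GKCFeasible n m D z ×
  (∀ z' → GKCFeasible n m D z' → GKCCost n m f z ≤∞ GKCCost n m f z')

lastHalf : ℕ → (ℕ → ℚ) → ℕ
lastHalf zero    h = 0
lastHalf (suc k) h with ½ ≤? h (suc k)
... | yes _ = suc k
... | no  _ = lastHalf k h

abar : {n m : ℕ} → (Fin n → Fin m → ℚ) → Fin n → ℕ
abar {n} {m} zb i = lastHalf m (zAt (zb i))

Dbar : {n m : ℕ} → ℕ → (Fin n → Fin m → ℚ) → ℕ
Dbar D zb = D ∸ Σℕ (abar zb)

mbar : {n : ℕ} → (m D : ℕ) → (Fin n → Fin m → ℚ) → Fin n → ℕ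
mbar m D zb i = m ⊓ℕ (abar zb i +ℕ Dbar D zb)

-- R-GKC variables: for item i, k : Fin (m̄_i - ā_i) stands for
-- j = ā_i + 1 + k ∈ {ā_i+1, …, m̄_i}.
RVars : (n m D : ℕ) → (Fin n → Fin m → ℚ) → Set
RVars n m D zb = (i : Fin n) → Fin (mbar m D zb i ∸ abar zb i) → ℚ

RFeasible : (n m D : ℕ) → (zb : Fin n → Fin m → ℚ) → RVars n m D zb → Set
RFeasible n m D zb z =
  ℕ→ℚ (2 *ℕ Dbar D zb) ≤ Σℚ (λ i → Σℚ (λ k → z i k)) ×
  (∀ i k → z i k ≤ 1ℚ) ×
  (∀ i k → 0ℚ ≤ z i k) ×
  (∀ i k k' → toℕ k ℕ.≤ toℕ k' → z i k' ≤ z i k)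

RCost : (n m D : ℕ) → (Fin n → ℕ → ℚ∞) → (zb : Fin n → Fin m → ℚ) → RVars n m D zb → ℚ∞
RCost n m D f zb z =
  Σ∞ (λ i → Σ∞ (λ k → gcoef f i (abar zb i +ℕ suc (toℕ k)) ·∞ z i k))

ROptimal : (n m D : ℕ) → (Fin n → ℕ → ℚ∞) → (zb : Fin n → Fin m → ℚ) → RVars n m D zb → Set
ROptimal n m D f zb z =
  RFeasible n m D zb z ×
  (∀ z' → RFeasible n m D zb z' → RCost n m D f zb z ≤∞ RCost n m D f zb z')

RExtreme : (n m D : ℕ) → (zb : Fin n → Fin m → ℚ) → RVars n m D zb → Set
RExtreme n m D zb z =
  RFeasible n m D zb z ×
  (∀ (y w : RVars n m D zb) (λ' : ℚ) → RFeasible n m D zb y → RFeasible n m D zb w →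
     0ℚ < λ' → λ' < 1ℚ →
     (∀ i k → z i k ≡ λ' * y i k + (1ℚ - λ') * w i k) →
     ∀ i k → y i k ≡ w i k)

Fractional : {n m D : ℕ} {zb : Fin n → Fin m → ℚ} → RVars n m D zb → Fin n → Set
Fractional z i = ∃ λ k → (0ℚ < z i k) × (z i k < 1ℚ)

-- With tent x = min(x, 1 - x), the map x ↦ x + c · tent x is
-- monotone on [0,1] for |c| ≤ 1, fixes 0 and 1, and moves every value in (0,1). Applying it
-- itemwise with weights c_k changes the covering sum by Σ c_k H_k, where H_k is the tent mass of
-- item k. If two distinct items i, i' had fractional entries, then H_i, H_i' > 0 and weights
-- supported on {i, i'} with Σ c_k H_k = 0 exist; both c and -c then give feasible points of
-- [R-GKC] whose midpoint is z* but which differ at the fractional entry of i.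
module Submission where

open import Defs
open import Data.Nat using (ℕ; suc; zero; _≤_; _<_)
open import Data.Fin using (Fin; zero; suc; toℕ)
open import Data.Fin.Properties using (_≟_)
open import Function using (_∘_)
open import Data.Rational
  using (ℚ; 0ℚ; 1ℚ; ½; -_; _+_; _*_; _-_; _⊓_; _⊔_; 1/_; Positive; NonZero; positive; nonNegative)
  renaming (_≤_ to _≤ℚ_; _<_ to _<ℚ_)
open import Data.Rational.Properties hiding (_≟_)
open import Data.Rational.Solver using (module +-*-Solver)
open import Data.Product using (_×_; _,_; proj₁; proj₂; Σ-syntax)
open import Data.Sum using (_⊎_; inj₁; inj₂)
open import Data.Empty using (⊥-elim)
open import Relation.Binary.Definitions using (tri<; tri≈; tri>)
open import Relation.Nullary using (¬_; yes; no)
open import Relation.Nullary.Decidable using (toWitness)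
open import Relation.Binary.PropositionalEquality
  using (_≡_; refl; sym; trans; cong; cong₂; subst; subst₂; module ≡-Reasoning)

open +-*-Solver using (solve; _:+_; _:*_; _:-_; :-_; _:=_; con)

tent : ℚ → ℚ
tent x = x ⊓ (1ℚ - x)

bend : ℚ → ℚ → ℚ
bend c x = x + c * tent x

tent-nonneg : ∀ {x} → 0ℚ ≤ℚ x → x ≤ℚ 1ℚ → 0ℚ ≤ℚ tent x
tent-nonneg {x} 0≤x x≤1 = ⊓-glb 0≤x (subst (_≤ℚ 1ℚ - x) (+-inverseʳ x) (+-monoˡ-≤ (- x) x≤1))

tent-pos : ∀ {x} → 0ℚ <ℚ x → x <ℚ 1ℚ → 0ℚ <ℚ tent x
tent-pos {x} 0<x x<1 with ⊓-sel x (1ℚ - x)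
... | inj₁ eq = subst (0ℚ <ℚ_) (sym eq) 0<x
... | inj₂ eq = subst (0ℚ <ℚ_) (sym eq) (subst (_<ℚ 1ℚ - x) (+-inverseʳ x) (+-monoˡ-< (- x) x<1))

x+tent≡ : ∀ x → x + tent x ≡ (x + x) ⊓ 1ℚ
x+tent≡ x = begin
  x + (x ⊓ (1ℚ - x))         ≡⟨ mono-≤-distrib-⊓ (+-monoʳ-≤ x) x (1ℚ - x) ⟩
  (x + x) ⊓ (x + (1ℚ - x))   ≡⟨ cong ((x + x) ⊓_) (solve 1 (λ x → x :+ (con 1ℚ :- x) := con 1ℚ) refl x) ⟩
  (x + x) ⊓ 1ℚ               ∎
  where open ≡-Reasoning

x-tent≡ : ∀ x → x - tent x ≡ 0ℚ ⊔ ((x + x) - 1ℚ)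
x-tent≡ x = begin
  x + - (x ⊓ (1ℚ - x))          ≡⟨ cong (x +_) (antimono-≤-distrib-⊓ neg-antimono-≤ x (1ℚ - x)) ⟩
  x + (- x ⊔ - (1ℚ - x))        ≡⟨ mono-≤-distrib-⊔ (+-monoʳ-≤ x) (- x) (- (1ℚ - x)) ⟩
  (x - x) ⊔ (x - (1ℚ - x))      ≡⟨ cong₂ _⊔_ (+-inverseʳ x) (solve 1 (λ x → x :- (con 1ℚ :- x) := (x :+ x) :- con 1ℚ) refl x) ⟩
  0ℚ ⊔ ((x + x) - 1ℚ)           ∎
  where open ≡-Reasoning

x+tent-mono : ∀ {x y} → x ≤ℚ y → x + tent x ≤ℚ y + tent y
x+tent-mono {x} {y} x≤y =
  subst₂ _≤ℚ_ (sym (x+tent≡ x)) (sym (x+tent≡ y)) (⊓-monoˡ-≤ 1ℚ (+-mono-≤ x≤y x≤y))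

x-tent-mono : ∀ {x y} → x ≤ℚ y → x - tent x ≤ℚ y - tent y
x-tent-mono {x} {y} x≤y =
  subst₂ _≤ℚ_ (sym (x-tent≡ x)) (sym (x-tent≡ y)) (⊔-monoʳ-≤ 0ℚ (+-monoˡ-≤ (- 1ℚ) (+-mono-≤ x≤y x≤y)))

1+c-nonneg : ∀ {c} → - 1ℚ ≤ℚ c → 0ℚ ≤ℚ 1ℚ + c
1+c-nonneg {c} -1≤c = subst (_≤ℚ 1ℚ + c) (+-inverseʳ 1ℚ) (+-monoʳ-≤ 1ℚ -1≤c)

1-c-nonneg : ∀ {c} → c ≤ℚ 1ℚ → 0ℚ ≤ℚ 1ℚ - c
1-c-nonneg {c} c≤1 = subst (_≤ℚ 1ℚ - c) (+-inverseʳ 1ℚ) (+-monoʳ-≤ 1ℚ (neg-antimono-≤ c≤1))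

-- For |c| ≤ 1 a nonnegative combination of the monotone maps x ± tent x.
bend-split : ∀ c x → bend c x ≡ ½ * ((1ℚ + c) * (x + tent x) + (1ℚ - c) * (x - tent x))
bend-split c x = solve 3 (λ c x t → x :+ c :* t
                                 := con ½ :* ((con 1ℚ :+ c) :* (x :+ t) :+ (con 1ℚ :- c) :* (x :- t)))
                   refl c x (tent x)

bend-mono : ∀ {c x y} → - 1ℚ ≤ℚ c → c ≤ℚ 1ℚ → x ≤ℚ y → bend c x ≤ℚ bend c y
bend-mono {c} {x} {y} -1≤c c≤1 x≤y =
  subst₂ _≤ℚ_ (sym (bend-split c x)) (sym (bend-split c y))
    (*-monoˡ-≤-nonNeg ½ (+-mono-≤
      (*-monoˡ-≤-nonNeg (1ℚ + c) {{nonNegative (1+c-nonneg -1≤c)}} (x+tent-mono x≤y))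
      (*-monoˡ-≤-nonNeg (1ℚ - c) {{nonNegative (1-c-nonneg c≤1)}} (x-tent-mono x≤y))))

bend-0 : ∀ c → bend c 0ℚ ≡ 0ℚ
bend-0 c = cong (0ℚ +_) (*-zeroʳ c)

bend-1 : ∀ c → bend c 1ℚ ≡ 1ℚ
bend-1 c = trans (cong (1ℚ +_) (*-zeroʳ c)) (+-identityʳ 1ℚ)

bend-average : ∀ c x → x ≡ ½ * bend c x + (1ℚ - ½) * bend (- c) x
bend-average c x = solve 3 (λ c x t → x := con ½ :* (x :+ c :* t) :+ (con 1ℚ :- con ½) :* (x :+ (:- c) :* t))
                     refl c x (tent x)

bend≡bend-neg : ∀ c x → bend c x ≡ bend (- c) x → c * tent x ≡ 0ℚ
bend≡bend-neg c x eq = begin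
  c * tent x                         ≡⟨ solve 3 (λ c x t → c :* t := con ½ :* ((x :+ c :* t) :- (x :+ (:- c) :* t)))
                                          refl c x (tent x) ⟩
  ½ * (bend c x - bend (- c) x)      ≡⟨ cong (λ y → ½ * (y - bend (- c) x)) eq ⟩
  ½ * (bend (- c) x - bend (- c) x)  ≡⟨ cong (½ *_) (+-inverseʳ (bend (- c) x)) ⟩
  ½ * 0ℚ                             ≡⟨ *-zeroʳ ½ ⟩
  0ℚ                                 ∎
  where open ≡-Reasoning

InUnitInterval : ℚ → Set
InUnitInterval x = 0ℚ ≤ℚ x × x ≤ℚ 1ℚ

complement-≤1 : ∀ {p q} → 0ℚ ≤ℚ q → p + q ≡ 1ℚ → p ≤ℚ 1ℚ
complement-≤1 {p} {q} 0≤q p+q≡1 = subst₂ _≤ℚ_ (+-identityʳ p) p+q≡1 (+-monoʳ-≤ p 0≤q)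

difference-bounds : ∀ {p q} → InUnitInterval p → InUnitInterval q → - 1ℚ ≤ℚ p - q × p - q ≤ℚ 1ℚ
difference-bounds {p} {q} (0≤p , p≤1) (0≤q , q≤1) =
  subst (_≤ℚ p - q) (+-identityˡ (- 1ℚ)) (+-mono-≤ 0≤p (neg-antimono-≤ q≤1)) ,
  subst (p - q ≤ℚ_) (+-identityʳ 1ℚ) (+-mono-≤ p≤1 (neg-antimono-≤ 0≤q))

unit-interval-trichotomy : ∀ {x} → 0ℚ ≤ℚ x → x ≤ℚ 1ℚ → x ≡ 0ℚ ⊎ x ≡ 1ℚ ⊎ (0ℚ <ℚ x × x <ℚ 1ℚ)
unit-interval-trichotomy {x} 0≤x x≤1 with <-cmp 0ℚ x | <-cmp x 1ℚ
... | tri≈ _ 0≡x _ | _            = inj₁ (sym 0≡x)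
... | tri> _ _ 0>x | _            = ⊥-elim (<-irrefl refl (<-≤-trans 0>x 0≤x))
... | tri< 0<x _ _ | tri< x<1 _ _ = inj₂ (inj₂ (0<x , x<1))
... | tri< _ _ _   | tri≈ _ x≡1 _ = inj₂ (inj₁ x≡1)
... | tri< _ _ _   | tri> _ _ x>1 = ⊥-elim (<-irrefl refl (≤-<-trans x≤1 x>1))

Σℚ-cong : ∀ {n} {f g : Fin n → ℚ} → (∀ k → f k ≡ g k) → Σℚ f ≡ Σℚ g
Σℚ-cong {zero}  f≡g = refl
Σℚ-cong {suc n} f≡g = cong₂ _+_ (f≡g zero) (Σℚ-cong (f≡g ∘ suc))

Σℚ-+ : ∀ {n} (f g : Fin n → ℚ) → Σℚ (λ k → f k + g k) ≡ Σℚ f + Σℚ g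
Σℚ-+ {zero}  f g = refl
Σℚ-+ {suc n} f g = trans (cong (f zero + g zero +_) (Σℚ-+ (f ∘ suc) (g ∘ suc)))
  (solve 4 (λ a b c d → (a :+ b) :+ (c :+ d) := (a :+ c) :+ (b :+ d)) refl
     (f zero) (g zero) (Σℚ (f ∘ suc)) (Σℚ (g ∘ suc)))

Σℚ-* : ∀ {n} c (f : Fin n → ℚ) → Σℚ (λ k → c * f k) ≡ c * Σℚ f
Σℚ-* {zero}  c f = sym (*-zeroʳ c)
Σℚ-* {suc n} c f = trans (cong (c * f zero +_) (Σℚ-* c (f ∘ suc))) (sym (*-distribˡ-+ c _ _))

Σℚ-nonneg : ∀ {n} (f : Fin n → ℚ) → (∀ k → 0ℚ ≤ℚ f k) → 0ℚ ≤ℚ Σℚ f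
Σℚ-nonneg {zero}  f 0≤f = ≤-refl
Σℚ-nonneg {suc n} f 0≤f = +-mono-≤ (0≤f zero) (Σℚ-nonneg (f ∘ suc) (0≤f ∘ suc))

Σℚ-pos : ∀ {n} (f : Fin n → ℚ) → (∀ k → 0ℚ ≤ℚ f k) → ∀ j → 0ℚ <ℚ f j → 0ℚ <ℚ Σℚ f
Σℚ-pos {suc n} f 0≤f zero    0<fj = +-mono-<-≤ 0<fj (Σℚ-nonneg (f ∘ suc) (0≤f ∘ suc))
Σℚ-pos {suc n} f 0≤f (suc j) 0<fj = +-mono-≤-< (0≤f zero) (Σℚ-pos (f ∘ suc) (0≤f ∘ suc) j 0<fj)

pointMass : ∀ {n} → Fin n → ℚ → Fin n → ℚ
pointMass zero    v zero    = v
pointMass zero    v (suc k) = 0ℚ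
pointMass (suc i) v zero    = 0ℚ
pointMass (suc i) v (suc k) = pointMass i v k

pointMass-self : ∀ {n} (i : Fin n) v → pointMass i v i ≡ v
pointMass-self zero    v = refl
pointMass-self (suc i) v = pointMass-self i v

pointMass-≢ : ∀ {n} {i k : Fin n} v → ¬ k ≡ i → pointMass i v k ≡ 0ℚ
pointMass-≢ {i = zero}  {zero}  v k≢i = ⊥-elim (k≢i refl)
pointMass-≢ {i = zero}  {suc k} v k≢i = refl
pointMass-≢ {i = suc i} {zero}  v k≢i = refl
pointMass-≢ {i = suc i} {suc k} v k≢i = pointMass-≢ v (k≢i ∘ cong suc)

pointMass-closed : (P : ℚ → Set) → P 0ℚ → ∀ {v} → P v → ∀ {n} (i k : Fin n) → P (pointMass i v k)
pointMass-closed P P0 Pv zero    zero    = Pv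
pointMass-closed P P0 Pv zero    (suc k) = P0
pointMass-closed P P0 Pv (suc i) zero    = P0
pointMass-closed P P0 Pv (suc i) (suc k) = pointMass-closed P P0 Pv i k

Σℚ-pointMass : ∀ {n} (i : Fin n) v (g : Fin n → ℚ) → Σℚ (λ k → pointMass i v k * g k) ≡ v * g i
Σℚ-pointMass zero v g = begin
  v * g zero + Σℚ (λ k → 0ℚ * g (suc k))  ≡⟨ cong (v * g zero +_) (Σℚ-* 0ℚ (g ∘ suc)) ⟩
  v * g zero + 0ℚ * Σℚ (g ∘ suc)          ≡⟨ cong (v * g zero +_) (*-zeroˡ (Σℚ (g ∘ suc))) ⟩
  v * g zero + 0ℚ                         ≡⟨ +-identityʳ _ ⟩
  v * g zero                              ∎
  where open ≡-Reasoning
Σℚ-pointMass (suc i) v g = trans (cong₂ _+_ (*-zeroˡ (g zero)) (Σℚ-pointMass i v (g ∘ suc))) (+-identityˡ _)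

BalancingWeights : ∀ {n} → (Fin n → ℚ) → Fin n → Set
BalancingWeights {n} H i = Σ[ c ∈ (Fin n → ℚ) ]
  (∀ k → - 1ℚ ≤ℚ c k × c k ≤ℚ 1ℚ) × Σℚ (λ k → c k * H k) ≡ 0ℚ × 0ℚ <ℚ c i

-- c i = H i' / (H i + H i') and c i' = - H i / (H i + H i').
balancing-weights : ∀ {n} (H : Fin n → ℚ) {i i' : Fin n} → ¬ i ≡ i' → 0ℚ ≤ℚ H i → 0ℚ <ℚ H i' →
                    BalancingWeights H i
balancing-weights H {i} {i'} i≢i' 0≤Hi 0<Hi' = c , bounds , balanced , 0<ci
  where
  total : ℚ
  total = H i + H i'
  instance
    total-pos : Positive total
    total-pos = positive (+-mono-≤-< 0≤Hi 0<Hi')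
    total-nonZero : NonZero total
    total-nonZero = pos⇒nonZero total
  s : ℚ
  s = 1/ total
  0<s : 0ℚ <ℚ s
  0<s = positive⁻¹ s {{1/pos⇒pos total}}
  a b : ℚ
  a = H i' * s
  b = H i * s
  0<a : 0ℚ <ℚ a
  0<a = positive⁻¹ a {{pos*pos⇒pos (H i') {{positive 0<Hi'}} s {{positive 0<s}}}}
  0≤b : 0ℚ ≤ℚ b
  0≤b = nonNegative⁻¹ b {{nonNeg*nonNeg⇒nonNeg (H i) {{nonNegative 0≤Hi}} s {{nonNegative (<⇒≤ 0<s)}}}}
  a+b≡1 : a + b ≡ 1ℚ
  a+b≡1 = trans (solve 3 (λ h h' s → h' :* s :+ h :* s := (h :+ h') :* s) refl (H i) (H i') s)
                (*-inverseʳ total)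
  a∈[0,1] : InUnitInterval a
  a∈[0,1] = <⇒≤ 0<a , complement-≤1 0≤b a+b≡1
  b∈[0,1] : InUnitInterval b
  b∈[0,1] = 0≤b , complement-≤1 (<⇒≤ 0<a) (trans (+-comm b a) a+b≡1)
  0∈[0,1] : InUnitInterval 0ℚ
  0∈[0,1] = ≤-refl , <⇒≤ (positive⁻¹ 1ℚ)
  c : Fin _ → ℚ
  c k = pointMass i a k - pointMass i' b k
  bounds : ∀ k → - 1ℚ ≤ℚ c k × c k ≤ℚ 1ℚ
  bounds k = difference-bounds (pointMass-closed InUnitInterval 0∈[0,1] a∈[0,1] i k)
                               (pointMass-closed InUnitInterval 0∈[0,1] b∈[0,1] i' k)
  balanced : Σℚ (λ k → c k * H k) ≡ 0ℚ
  balanced = begin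
    Σℚ (λ k → c k * H k)
      ≡⟨ Σℚ-cong (λ k → solve 3 (λ p q h → (p :- q) :* h := p :* h :+ con (- 1ℚ) :* (q :* h)) refl
                          (pointMass i a k) (pointMass i' b k) (H k)) ⟩
    Σℚ (λ k → pointMass i a k * H k + - 1ℚ * (pointMass i' b k * H k))
      ≡⟨ Σℚ-+ (λ k → pointMass i a k * H k) (λ k → - 1ℚ * (pointMass i' b k * H k)) ⟩
    Σℚ (λ k → pointMass i a k * H k) + Σℚ (λ k → - 1ℚ * (pointMass i' b k * H k))
      ≡⟨ cong (Σℚ (λ k → pointMass i a k * H k) +_) (Σℚ-* (- 1ℚ) (λ k → pointMass i' b k * H k)) ⟩
    Σℚ (λ k → pointMass i a k * H k) + - 1ℚ * Σℚ (λ k → pointMass i' b k * H k)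
      ≡⟨ cong₂ (λ x y → x + - 1ℚ * y) (Σℚ-pointMass i a H) (Σℚ-pointMass i' b H) ⟩
    a * H i + - 1ℚ * (b * H i')
      ≡⟨ solve 3 (λ h h' s → h' :* s :* h :+ con (- 1ℚ) :* (h :* s :* h') := con 0ℚ) refl (H i) (H i') s ⟩
    0ℚ ∎
    where open ≡-Reasoning
  0<ci : 0ℚ <ℚ c i
  0<ci = subst (0ℚ <ℚ_) (sym (trans (cong₂ _-_ (pointMass-self i a) (pointMass-≢ b i≢i')) (+-identityʳ a))) 0<a

neg-bounds : ∀ {c} → - 1ℚ ≤ℚ c × c ≤ℚ 1ℚ → - 1ℚ ≤ℚ - c × - c ≤ℚ 1ℚ
neg-bounds (-1≤c , c≤1) = neg-antimono-≤ c≤1 , neg-antimono-≤ -1≤c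

neg-balanced : ∀ {n} (c H : Fin n → ℚ) → Σℚ (λ k → c k * H k) ≡ 0ℚ → Σℚ (λ k → - c k * H k) ≡ 0ℚ
neg-balanced c H balanced = begin
  Σℚ (λ k → - c k * H k)          ≡⟨ Σℚ-cong (λ k → solve 2 (λ c h → (:- c) :* h := con (- 1ℚ) :* (c :* h)) refl (c k) (H k)) ⟩
  Σℚ (λ k → - 1ℚ * (c k * H k))   ≡⟨ Σℚ-* (- 1ℚ) (λ k → c k * H k) ⟩
  - 1ℚ * Σℚ (λ k → c k * H k)     ≡⟨ cong (- 1ℚ *_) balanced ⟩
  - 1ℚ * 0ℚ                       ≡⟨ *-zeroʳ (- 1ℚ) ⟩
  0ℚ                              ∎
  where open ≡-Reasoning

module TentPerturbation (n m D : ℕ) (zb : Fin n → Fin m → ℚ) (z : RVars n m D zb) where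

  tentMass : Fin n → ℚ
  tentMass i = Σℚ (λ j → tent (z i j))

  bent : (Fin n → ℚ) → RVars n m D zb
  bent c i j = bend (c i) (z i j)

  Σℚ-bent : ∀ c → Σℚ (λ i → Σℚ (λ j → bent c i j))
                 ≡ Σℚ (λ i → Σℚ (λ j → z i j)) + Σℚ (λ i → c i * tentMass i)
  Σℚ-bent c = trans
    (Σℚ-cong λ i → trans (Σℚ-+ (z i) (λ j → c i * tent (z i j)))
                         (cong (Σℚ (z i) +_) (Σℚ-* (c i) (λ j → tent (z i j)))))
    (Σℚ-+ (λ i → Σℚ (z i)) (λ i → c i * tentMass i))

  bent-feasible : RFeasible n m D zb z → ∀ c → (∀ i → - 1ℚ ≤ℚ c i × c i ≤ℚ 1ℚ) →
                  Σℚ (λ i → c i * tentMass i) ≡ 0ℚ → RFeasible n m D zb (bent c)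
  bent-feasible (covers , ≤1 , 0≤ , antitone) c bounds balanced =
    ≤-trans covers (≤-reflexive (sym (trans (Σℚ-bent c)
                     (trans (cong (Σℚ (λ i → Σℚ (z i)) +_) balanced) (+-identityʳ _))))) ,
    (λ i j → subst (bent c i j ≤ℚ_) (bend-1 (c i)) (mono i (≤1 i j))) ,
    (λ i j → subst (_≤ℚ bent c i j) (bend-0 (c i)) (mono i (0≤ i j))) ,
    (λ i j j' j≤j' → mono i (antitone i j j' j≤j'))
    where
    mono : ∀ i {x y} → x ≤ℚ y → bend (c i) x ≤ℚ bend (c i) y
    mono i = bend-mono (proj₁ (bounds i)) (proj₂ (bounds i))

  tentMass-nonneg : RFeasible n m D zb z → ∀ i → 0ℚ ≤ℚ tentMass i
  tentMass-nonneg (_ , ≤1 , 0≤ , _) i = Σℚ-nonneg _ (λ j → tent-nonneg (0≤ i j) (≤1 i j))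

  tentMass-pos : RFeasible n m D zb z → ∀ i → Fractional {n} {m} {D} {zb} z i → 0ℚ <ℚ tentMass i
  tentMass-pos (_ , ≤1 , 0≤ , _) i (j , 0<zij , zij<1) =
    Σℚ-pos _ (λ j → tent-nonneg (0≤ i j) (≤1 i j)) j (tent-pos 0<zij zij<1)

  extreme⇒¬balanced-fractional : RExtreme n m D zb z → ∀ {i} → BalancingWeights tentMass i →
                                 ¬ Fractional {n} {m} {D} {zb} z i
  extreme⇒¬balanced-fractional (feasible , extreme) {i} (c , bounds , balanced , 0<ci) (k , 0<zik , zik<1) =
    <⇒≢ 0<ci*tent (sym (bend≡bend-neg (c i) (z i k) (y≡w i k)))
    where
    -c : Fin n → ℚ
    -c k = - c k
    y≡w : ∀ i k → bent c i k ≡ bent -c i k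
    y≡w = extreme (bent c) (bent -c) ½
            (bent-feasible feasible c bounds balanced)
            (bent-feasible feasible -c (neg-bounds ∘ bounds) (neg-balanced c tentMass balanced))
            (positive⁻¹ ½) (toWitness {a? = ½ <? 1ℚ} _)
            (λ i k → bend-average (c i) (z i k))
    0<ci*tent : 0ℚ <ℚ c i * tent (z i k)
    0<ci*tent = positive⁻¹ (c i * tent (z i k))
                  {{pos*pos⇒pos (c i) {{positive 0<ci}} (tent (z i k)) {{positive (tent-pos 0<zik zik<1)}}}}

  fractional-unique : RExtreme n m D zb z →
    ∀ i i' → Fractional {n} {m} {D} {zb} z i → Fractional {n} {m} {D} {zb} z i' → i ≡ i'
  fractional-unique extreme@(feasible , _) i i' frac-i frac-i' with i ≟ i'
  ... | yes i≡i' = i≡i'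
  ... | no  i≢i' = ⊥-elim (extreme⇒¬balanced-fractional extreme
                     (balancing-weights tentMass i≢i' (tentMass-nonneg feasible i) (tentMass-pos feasible i' frac-i'))
                     frac-i)

  others-integral : RExtreme n m D zb z → ∀ i → Fractional {n} {m} {D} {zb} z i →
                    ∀ k → ¬ k ≡ i → ∀ j → z k j ≡ 0ℚ ⊎ z k j ≡ 1ℚ
  others-integral extreme@((_ , ≤1 , 0≤ , _) , _) i frac-i k k≢i j
    with unit-interval-trichotomy (0≤ k j) (≤1 k j)
  ... | inj₁ zkj≡0          = inj₁ zkj≡0
  ... | inj₂ (inj₁ zkj≡1)   = inj₂ zkj≡1
  ... | inj₂ (inj₂ frac-kj) = ⊥-elim (k≢i (fractional-unique extreme k i (j , frac-kj) frac-i))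

lemma3 : (n m D : ℕ) → m ≤ D →
    (f : Fin n → ℕ → ℚ∞) →
    (∀ i j → j ≤ m → NonNeg∞ (f i j)) →
    (∀ i j → j < m → f i j ≤∞ f i (suc j)) →
    (zb : Fin n → Fin m → ℚ) →
    GKCOptimal n m D f zb →
    (∀ i j → zb i j ≤ℚ 1ℚ) →
    (∀ i j → 0ℚ ≤ℚ zb i j) →
    (∀ i j j' → toℕ j ≤ toℕ j' → zb i j' ≤ℚ zb i j) →
    (zs : RVars n m D zb) →
    ROptimal n m D f zb zs →
    RExtreme n m D zb zs →
    (∀ i i' → Fractional {n} {m} {D} {zb} zs i → Fractional {n} {m} {D} {zb} zs i' → i ≡ i') ×
    (∀ i → Fractional {n} {m} {D} {zb} zs i →
       ∀ k → ¬ k ≡ i → ∀ j → zs k j ≡ 0ℚ ⊎ zs k j ≡ 1ℚ)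
lemma3 n m D _ f _ _ zb _ _ _ _ zs _ extreme = fractional-unique extreme , others-integral extreme
  where open TentPerturbation n m D zb zs
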